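{- Let $M$ be a partial commutative monoid and $(\{\mathbb{E}_m\}_{m\in M},\nabla,\eta)$ an $M$-graded effect monoid. Then $\{D_{\mathbb{E}_m}\}_{m\in M}$ is an $M$-graded monad on $\mathbf{Set}$ with unit $\eta_X: X\to D_{\mathbb{E}_0}X$, $\eta_X(x)=1_{\mathbb{E}_0}\bullet x$, and multiplication $\mu_{m,n}:D_{\mathbb{E}_m}D_{\mathbb{E}_n}\to D_{\mathbb{E}_{m+n}}$ (for $m\perp n$) given by $\mu_{m,n}\big(\sum_i e_i\bullet\Delta_i\big)(x)=\sum_i\nabla_{m,n}(e_i,\Delta_i(x))$.
   Context: A partial commutative monoid (PCM) $\langle M,0,+\rangle$ has a partial, commutative, associative binary operation $+$ (write $a\perp b$ when $a+b$ is defined) with $0\perp a$, $0+a=a$ for all $a$; associativity means: if $b\perp c$ and $a\perp(b+c)$ then $a\perp b$, $(a+b)\perp c$ and $(a+b)+c=a+(b+c)$. An effect algebra is a PCM $\langle\mathbb{E},0,+\rangle$ with a unary operation $e\mapsto e'$ such that $e'$ is the unique element with $e+e'=1$ where $1=0'$, and $e\perp 1$ implies $e=0$; its order is $a\sqsubseteq b$ iff $a+c=b$ for some $c$. Effect morphisms preserve $0$, defined sums and $'$. The category $\mathbf{EA}$ is symmetric monoidal with unit $2=\{0,1\}$, and morphisms $\mathbb{E}_A\otimes\mathbb{E}_B\to\mathbb{E}_C$ correspond to bimorphisms (maps that are PCM homomorphisms in each argument and send $(1,1)$ to $1$). An $M$-graded effect monoid consists of effect algebras $\mathbb{E}_m$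 ($m\in M$), effect morphisms $\nabla_{m,n}:\mathbb{E}_m\otimes\mathbb{E}_n\to\mathbb{E}_{m+n}$ for $m\perp n$ (viewed as bimorphisms), and an effect morphism $\eta:2\to\mathbb{E}_0$, satisfying associativity $\nabla_{m+n,o}(\nabla_{m,n}(a,b),c)=\nabla_{m,n+o}(a,\nabla_{n,o}(b,c))$ and unitality $\nabla_{0,m}(\eta(1),a)=a=\nabla_{m,0}(a,\eta(1))$. For an effect algebra $\mathbb{E}$, $D_{\mathbb{E}}:\mathbf{Set}\to\mathbf{Set}$ sends $X$ to the set of $\Delta:X\to\mathbb{E}$ with finite support $\mathrm{supp}(\Delta)=\{x:\Delta(x)\neq0\}$ such that $\sum_{x\in\mathrm{supp}(\Delta)}\Delta(x)$ is defined (and is $\sqsubseteq 1$), and sends $f:X\to Y$ to $(D_{\mathbb{E}}f)(\Delta)(y)=\sum_{x\in f^{ -1}(y)}\Delta(x)$. We write $\sum_i e_i\bullet x_i$ for the distribution assigning $e_i$ to $x_i$. An $M$-graded monad on $\mathbf{Set}$ consists of endofunctors $T_m$ ($m\in M$), a natural transformation $\eta:\mathrm{Id}\to T_0$, and natural transformations $\mu_{m,n}:T_mT_n\to T_{m+n}$ for $m\perp n$, such that $\mu_{m,n+o}\circ T_m\mu_{n,o}=\mu_{m+n,o}\circ\mu_{m,n}T_o$ whenever the grades are orthogonal, and $\mu_{m,0}\circ T_m\eta=\mathrm{id}_{T_m}=\mu_{0,m}\circ\eta T_m$. -}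

module Defs where

open import Level using (0ℓ)
open import Data.Bool using (Bool; true; false; not)
open import Data.Product using (Σ; _×_; _,_)
open import Data.List using (List; []; _∷_; map)
open import Data.List.Membership.Propositional using (_∈_)
open import Data.List.Relation.Unary.Unique.Propositional using (Unique)
open import Relation.Binary.PropositionalEquality using (_≡_; _≢_; refl)
open import Function using (id; _∘_)

-- The partial operation is given by its graph:  a ⊕ b ≈ c  means
-- "a ⊥ b and a + b = c".  The graph is a proof-irrelevant, functional
-- relation (so it is exactly a partial function on Carrier × Carrier).

record PCM : Set₁ where
  field
    Carrier      : Set
    0#           : Carrier
    _⊕_≈_        : Carrier → Carrier → Carrier → Set
    ⊕-irrelevant : ∀ {a b c} (p q : a ⊕ b ≈ c) → p ≡ q
    ⊕-functional : ∀ {a b c d} → a ⊕ b ≈ c → a ⊕ b ≈ d → c ≡ d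
    ⊕-comm       : ∀ {a b c} → a ⊕ b ≈ c → b ⊕ a ≈ c
    ⊕-identityˡ  : ∀ a → 0# ⊕ a ≈ a
    ⊕-assoc      : ∀ {a b c bc abc} → b ⊕ c ≈ bc → a ⊕ bc ≈ abc →
                   Σ Carrier (λ ab → (a ⊕ b ≈ ab) × (ab ⊕ c ≈ abc))

record EffectAlgebra : Set₁ where
  field
    pcm : PCM
  open PCM pcm public
  field
    _′        : Carrier → Carrier
    ′-sum     : ∀ e → e ⊕ (e ′) ≈ (0# ′)
    ′-unique  : ∀ {e d} → e ⊕ d ≈ (0# ′) → d ≡ e ′
    zero-one  : ∀ {e c} → e ⊕ (0# ′) ≈ c → e ≡ 0#

  1# : Carrier
  1# = 0# ′

open EffectAlgebra using () renaming (Carrier to ⟨_⟩)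

record IsPCMHom (A B : EffectAlgebra) (f : ⟨ A ⟩ → ⟨ B ⟩) : Set where
  private
    module A = EffectAlgebra A
    module B = EffectAlgebra B
  field
    pres-0 : f A.0# ≡ B.0#
    pres-⊕ : ∀ {a b c} → a A.⊕ b ≈ c → (f a) B.⊕ (f b) ≈ (f c)

record IsEffectMorphism (A B : EffectAlgebra) (f : ⟨ A ⟩ → ⟨ B ⟩) : Set where
  private
    module A = EffectAlgebra A
    module B = EffectAlgebra B
  field
    pres-0 : f A.0# ≡ B.0#
    pres-⊕ : ∀ {a b c} → a A.⊕ b ≈ c → (f a) B.⊕ (f b) ≈ (f c)
    pres-′ : ∀ a → f (a A.′) ≡ (f a) B.′

-- bimorphisms A × B → C  (= effect morphisms A ⊗ B → C)
record IsBimorphism (A B C : EffectAlgebra) (g : ⟨ A ⟩ → ⟨ B ⟩ → ⟨ C ⟩) : Set where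
  private
    module A = EffectAlgebra A
    module B = EffectAlgebra B
    module C = EffectAlgebra C
  field
    homˡ : ∀ b → IsPCMHom A C (λ a → g a b)
    homʳ : ∀ a → IsPCMHom B C (g a)
    pres-1 : g A.1# B.1# ≡ C.1#

data TwoSum : Bool → Bool → Bool → Set where
  0+b : ∀ b → TwoSum false b b
  1+0 : TwoSum true false true

private
  two-irr : ∀ {a b c} (p q : TwoSum a b c) → p ≡ q
  two-irr (0+b _) (0+b _) = refl
  two-irr 1+0 1+0 = refl

  two-fun : ∀ {a b c d} → TwoSum a b c → TwoSum a b d → c ≡ d
  two-fun (0+b _) (0+b _) = refl
  two-fun 1+0 1+0 = refl

  two-comm : ∀ {a b c} → TwoSum a b c → TwoSum b a c
  two-comm (0+b false) = 0+b false
  two-comm (0+b true) = 1+0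
  two-comm 1+0 = 0+b true

  two-assoc : ∀ {a b c bc abc} → TwoSum b c bc → TwoSum a bc abc →
              Σ Bool (λ ab → TwoSum a b ab × TwoSum ab c abc)
  two-assoc {b = b} p (0+b _) = b , 0+b b , p
  two-assoc (0+b .false) 1+0 = true , 1+0 , 1+0

  two-′-sum : ∀ e → TwoSum e (not e) true
  two-′-sum false = 0+b true
  two-′-sum true = 1+0

  two-′-unique : ∀ {e d} → TwoSum e d true → d ≡ not e
  two-′-unique (0+b .true) = refl
  two-′-unique 1+0 = refl

  two-zero-one : ∀ {e c} → TwoSum e true c → e ≡ false
  two-zero-one (0+b .true) = refl

Two : EffectAlgebra
Two = record
  { pcm = record
    { Carrier = Bool
    ; 0# = false
    ; _⊕_≈_ = TwoSum
    ; ⊕-irrelevant = two-irr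
    ; ⊕-functional = two-fun
    ; ⊕-comm = two-comm
    ; ⊕-identityˡ = 0+b
    ; ⊕-assoc = two-assoc
    }
  ; _′ = not
  ; ′-sum = two-′-sum
  ; ′-unique = two-′-unique
  ; zero-one = two-zero-one
  }

record GradedEffectMonoid (M : PCM) : Set₁ where
  open PCM M using (_⊕_≈_) renaming (Carrier to Grade; 0# to 0g)
  field
    E        : Grade → EffectAlgebra
    -- ∇_{m,n} : E_m ⊗ E_n → E_{m+n}, for m ⊥ n, as a bimorphism
    ∇        : ∀ {m n k} → m ⊕ n ≈ k → ⟨ E m ⟩ → ⟨ E n ⟩ → ⟨ E k ⟩
    ∇-bimorphism : ∀ {m n k} (p : m ⊕ n ≈ k) → IsBimorphism (E m) (E n) (E k) (∇ p)
    η        : Bool → ⟨ E 0g ⟩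
    η-morphism : IsEffectMorphism Two (E 0g) η
    ∇-assoc  : ∀ {m n o mn no k}
               (p : m ⊕ n ≈ mn) (q : mn ⊕ o ≈ k) (r : n ⊕ o ≈ no) (s : m ⊕ no ≈ k)
               (a : ⟨ E m ⟩) (b : ⟨ E n ⟩) (c : ⟨ E o ⟩) →
               ∇ q (∇ p a b) c ≡ ∇ s a (∇ r b c)
    ∇-identityˡ : ∀ {m} (p : 0g ⊕ m ≈ m) (a : ⟨ E m ⟩) → ∇ p (η true) a ≡ a
    ∇-identityʳ : ∀ {m} (p : m ⊕ 0g ≈ m) (a : ⟨ E m ⟩) → ∇ p a (η true) ≡ a

data SumList (A : EffectAlgebra) : List ⟨ A ⟩ → ⟨ A ⟩ → Set where
  []  : SumList A [] (EffectAlgebra.0# A)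
  _∷_ : ∀ {a as b c} → EffectAlgebra._⊕_≈_ A a b c → SumList A as b →
        SumList A (a ∷ as) c

Enumerates : {X : Set} → List X → (X → Set) → Set
Enumerates {X} L P = Unique L × (∀ x → x ∈ L → P x) × (∀ x → P x → x ∈ L)

IsDistribution : (A : EffectAlgebra) {X : Set} → (X → ⟨ A ⟩) → Set
IsDistribution A {X} Δ =
  Σ (List X) λ L → Enumerates L (λ x → Δ x ≢ EffectAlgebra.0# A)
                   × Σ ⟨ A ⟩ (SumList A (map Δ L))

-- D_E X.  The finiteness witness is an irrelevant field, so two elements
-- of D_E X are equal as soon as their underlying functions are equal.
record Dist (A : EffectAlgebra) (X : Set) : Set where
  constructor dist
  field
    fun     : X → ⟨ A ⟩
    .finite : IsDistribution A fun
open Dist public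

FmapSpec : (A : EffectAlgebra) {X Y : Set} → (X → Y) → Dist A X → Dist A Y → Set
FmapSpec A {X} f Δ Δ' = ∀ y →
  Σ (List X) λ L → Enumerates L (λ x → (f x ≡ y) × (fun Δ x ≢ EffectAlgebra.0# A))
                   × SumList A (map (fun Δ) L) (fun Δ' y)

record DGradedMonad (M : PCM) (G : GradedEffectMonoid M) : Set₁ where
  open PCM M using (_⊕_≈_) renaming (Carrier to Grade; 0# to 0g)
  open GradedEffectMonoid G
  D : Grade → Set → Set
  D m X = Dist (E m) X
  field
    fmap      : ∀ m {X Y : Set} → (X → Y) → D m X → D m Y
    fmap-spec : ∀ m {X Y : Set} (f : X → Y) (Δ : D m X) → FmapSpec (E m) f Δ (fmap m f Δ)
    fmap-id   : ∀ m {X : Set} (Δ : D m X) → fmap m id Δ ≡ Δ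
    fmap-∘    : ∀ m {X Y Z : Set} (f : X → Y) (g : Y → Z) (Δ : D m X) →
                fmap m (g ∘ f) Δ ≡ fmap m g (fmap m f Δ)
    unit      : ∀ {X : Set} → X → D 0g X
    unit-spec : ∀ {X : Set} (x : X) →
                (fun (unit x) x ≡ EffectAlgebra.1# (E 0g))
                × (∀ y → y ≢ x → fun (unit x) y ≡ EffectAlgebra.0# (E 0g))
    mult      : ∀ {m n k} → m ⊕ n ≈ k → ∀ {X : Set} → D m (D n X) → D k X
    mult-spec : ∀ {m n k} (p : m ⊕ n ≈ k) {X : Set} (Φ : D m (D n X)) (x : X) →
                Σ (List (D n X)) λ L →
                  Enumerates L (λ Δ → fun Φ Δ ≢ EffectAlgebra.0# (E m))
                  × SumList (E k) (map (λ Δ → ∇ p (fun Φ Δ) (fun Δ x)) L) (fun (mult p Φ) x)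
    unit-natural : ∀ {X Y : Set} (f : X → Y) (x : X) → fmap 0g f (unit x) ≡ unit (f x)
    mult-natural : ∀ {m n k} (p : m ⊕ n ≈ k) {X Y : Set} (f : X → Y) (Φ : D m (D n X)) →
                   mult p (fmap m (fmap n f) Φ) ≡ fmap k f (mult p Φ)
    mult-assoc : ∀ {m n o mn no k}
                 (p : m ⊕ n ≈ mn) (q : mn ⊕ o ≈ k) (r : n ⊕ o ≈ no) (s : m ⊕ no ≈ k)
                 {X : Set} (Φ : D m (D n (D o X))) →
                 mult s (fmap m (mult r) Φ) ≡ mult q (mult p Φ)
    mult-unitʳ : ∀ {m} (p : m ⊕ 0g ≈ m) {X : Set} (Δ : D m X) → mult p (fmap m unit Δ) ≡ Δ
    mult-unitˡ : ∀ {m} (p : 0g ⊕ m ≈ m) {X : Set} (Δ : D m X) → mult p (unit Δ) ≡ Δ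

module Submission where

-- With excluded middle, a family g : X → E with finite support whose partial sum is defined has a
-- well-defined sum: the sum over a duplicate-free list covering the support does not depend on the
-- list, since it is invariant under permutations and under adding zero terms.  D_E f sums over the
-- fibres of f, and μ sums the terms ∇(Φ Δ, Δ x); the latter sum exists because ∇(Φ Δ, Σ Δ) is a
-- summand of ∇(Φ Δ, 1), and these add up to ∇(Σ Φ, 1).  Each monad law is then an interchange of a
-- finite double sum (Fubini for partial sums, obtained by adding the rows one at a time with
-- (a + b) + (c + d) = (a + c) + (b + d)), combined with the bimorphism, associativity and unit laws
-- of ∇ and η.

open import Defs
open import Level using (0ℓ)
open import Axiom.DoubleNegationElimination using (em⇒dne)
open import Axiom.ExcludedMiddle using (ExcludedMiddle)
open import Axiom.Extensionality.Propositional using (Extensionality)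
open import Data.Bool using (true; false)
open import Data.Empty using (⊥-elim; ⊥-elim-irr)
open import Data.List using (List; []; _∷_; map; filter; concat; deduplicate)
open import Data.List.Membership.Propositional using (_∈_; _∉_)
open import Data.List.Membership.Propositional.Properties
  using (∈-filter⁺; ∈-filter⁻; ∈-concat⁺′; ∈-map⁺; ∈-deduplicate⁺)
open import Data.List.Membership.Propositional.Properties.WithK using (unique∧set⇒bag)
open import Data.List.Properties using (map-cong; map-cong-local; map-id)
open import Data.List.Relation.Binary.BagAndSetEquality using (∼bag⇒↭)
import Data.List.Relation.Binary.Permutation.Propositional as ↭
open ↭ using (_↭_)
open import Data.List.Relation.Binary.Permutation.Propositional.Properties using () renaming (map⁺ to ↭-map⁺)
open import Data.List.Relation.Binary.Pointwise as Pointwise using (Pointwise; []; _∷_; Pointwise-≡⇒≡)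
open import Data.List.Relation.Unary.All as All using (All; []; _∷_)
open import Data.List.Relation.Unary.All.Properties using (map⁻)
open import Data.List.Relation.Unary.Any using (here; there)
open import Data.List.Relation.Unary.Unique.Propositional using (Unique; []; _∷_)
import Data.List.Relation.Unary.Unique.Propositional.Properties as Unique
import Data.List.Relation.Unary.Unique.DecPropositional.Properties as UniqueDec
open import Data.Product as Product using (Σ; ∃; _×_; _,_; proj₁; proj₂)
open import Function using (id; _∘_)
open import Function.Bundles using (mk⇔)
open import Relation.Binary using (DecidableEquality)
open import Relation.Binary.PropositionalEquality
open import Relation.Nullary using (yes; no; ¬?)
open import Relation.Unary using (Decidable)
open ≡-Reasoning

open EffectAlgebra using () renaming (Carrier to ⟨_⟩)

Pointwise-∈ : ∀ {A B : Set} {R : A → B → Set} {xs ys x} → Pointwise R xs ys → x ∈ xs → ∃ (R x)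
Pointwise-∈ (r ∷ _) (here refl) = _ , r
Pointwise-∈ (_ ∷ rs) (there x∈xs) = Pointwise-∈ rs x∈xs

Dist-≡ : ∀ {A : EffectAlgebra} {X : Set} {Δ Δ' : Dist A X} → fun Δ ≡ fun Δ' → Δ ≡ Δ'
Dist-≡ {Δ = dist _ _} {Δ' = dist _ _} refl = refl

module EffectAlgebraProperties (A : EffectAlgebra) where
  open EffectAlgebra A

  ⊕-identityʳ : ∀ a → a ⊕ 0# ≈ a
  ⊕-identityʳ a = ⊕-comm (⊕-identityˡ a)

  ⊕-identityˡ-unique : ∀ {b c} → 0# ⊕ b ≈ c → c ≡ b
  ⊕-identityˡ-unique p = ⊕-functional p (⊕-identityˡ _)

  ⊕-assocʳ : ∀ {a b c ab abc} → a ⊕ b ≈ ab → ab ⊕ c ≈ abc →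
             ∃ λ bc → (b ⊕ c ≈ bc) × (a ⊕ bc ≈ abc)
  ⊕-assocʳ p q with ⊕-assoc (⊕-comm p) (⊕-comm q)
  ... | _ , r , s = _ , ⊕-comm r , ⊕-comm s

  ⊕-exchange : ∀ {a b c bc abc} → a ⊕ bc ≈ abc → b ⊕ c ≈ bc →
               ∃ λ ac → (a ⊕ c ≈ ac) × (b ⊕ ac ≈ abc)
  ⊕-exchange p q with ⊕-assoc q p
  ... | _ , r , s = ⊕-assocʳ (⊕-comm r) s

  ⊕-interchange : ∀ {a b c d ab cd t} → a ⊕ b ≈ ab → c ⊕ d ≈ cd → ab ⊕ cd ≈ t →
                  ∃ λ ac → ∃ λ bd → (a ⊕ c ≈ ac) × (b ⊕ d ≈ bd) × (ac ⊕ bd ≈ t)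
  ⊕-interchange p q r with ⊕-assoc q r
  ... | _ , r₁ , r₂ with ⊕-assocʳ p r₁
  ... | _ , s₁ , s₂ with ⊕-assoc (⊕-comm s₁) s₂
  ... | _ , t₁ , t₂ with ⊕-assocʳ t₂ r₂
  ... | _ , u₁ , u₂ = _ , _ , t₁ , u₁ , u₂

  -- a + b = 0 makes a ⊥ 0′ = 1, hence a = 0
  ⊕-positive : ∀ {a b} → a ⊕ b ≈ 0# → a ≡ 0#
  ⊕-positive p with ⊕-assocʳ (⊕-comm p) (⊕-identityˡ 1#)
  ... | _ , q , _ = zero-one q

  SumList-functional : ∀ {L c d} → SumList A L c → SumList A L d → c ≡ d
  SumList-functional [] [] = refl
  SumList-functional (p ∷ s) (q ∷ t) rewrite SumList-functional s t = ⊕-functional p q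

  SumList-positive : ∀ {L} → SumList A L 0# → All (_≡ 0#) L
  SumList-positive [] = []
  SumList-positive (p ∷ s) =
    ⊕-positive p ∷ SumList-positive (subst (SumList A _) (⊕-positive (⊕-comm p)) s)

  SumList-↭ : ∀ {L L' c} → L ↭ L' → SumList A L c → SumList A L' c
  SumList-↭ ↭.refl s = s
  SumList-↭ (↭.prep x π) (p ∷ s) = p ∷ SumList-↭ π s
  SumList-↭ (↭.swap x y π) (p ∷ q ∷ s) with ⊕-exchange p q
  ... | _ , r₁ , r₂ = r₂ ∷ r₁ ∷ SumList-↭ π s
  SumList-↭ (↭.trans π ρ) s = SumList-↭ ρ (SumList-↭ π s)

module FiniteSums (em : ExcludedMiddle 0ℓ) (A : EffectAlgebra) where
  open EffectAlgebra A
  open EffectAlgebraProperties A public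

  SupportIn : {X : Set} → (X → Carrier) → List X → Set
  SupportIn g L = ∀ x → g x ≢ 0# → x ∈ L

  record Sums {X : Set} (g : X → Carrier) (c : Carrier) : Set where
    constructor sums
    field
      list    : List X
      unique  : Unique list
      covers  : SupportIn g list
      sumList : SumList A (map g list) c

  module _ {X : Set} (g : X → Carrier) where

    nonzero? : Decidable (λ x → g x ≢ 0#)
    nonzero? x = ¬? em

    SumList-filter⁺ : ∀ {L c} → SumList A (map g L) c → SumList A (map g (filter nonzero? L)) c
    SumList-filter⁺ {[]} [] = []
    SumList-filter⁺ {x ∷ L} (p ∷ s) with em {g x ≡ 0#}
    ... | yes gx≡0 =
      subst (SumList A _) (sym (⊕-identityˡ-unique (subst (λ a → a ⊕ _ ≈ _) gx≡0 p))) (SumList-filter⁺ s)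
    ... | no _ = p ∷ SumList-filter⁺ s

    SumList-filter⁻ : ∀ {L c} → SumList A (map g (filter nonzero? L)) c → SumList A (map g L) c
    SumList-filter⁻ {[]} [] = []
    SumList-filter⁻ {x ∷ L} s with em {g x ≡ 0#}
    ... | yes gx≡0 = subst (λ a → a ⊕ _ ≈ _) (sym gx≡0) (⊕-identityˡ _) ∷ SumList-filter⁻ s
    SumList-filter⁻ {x ∷ L} (p ∷ s) | no _ = p ∷ SumList-filter⁻ s

    filter-nonzero-↭ : ∀ {L L'} → Unique L → Unique L' → SupportIn g L → SupportIn g L' →
                       filter nonzero? L ↭ filter nonzero? L'
    filter-nonzero-↭ {L} {L'} u u' cov cov' = ∼bag⇒↭ (unique∧set⇒bag
      (Unique.filter⁺ nonzero? u) (Unique.filter⁺ nonzero? u') (mk⇔ (move L cov') (move L' cov)))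
      where
      move : ∀ L {L'} → SupportIn g L' → ∀ {x} → x ∈ filter nonzero? L → x ∈ filter nonzero? L'
      move L cov' m = let nz = proj₂ (∈-filter⁻ nonzero? {xs = L} m) in ∈-filter⁺ nonzero? (cov' _ nz) nz

  module _ {X : Set} where

    Sums⇒SumList : ∀ {g : X → Carrier} {c L} → Sums g c → Unique L → SupportIn g L → SumList A (map g L) c
    Sums⇒SumList {g} (sums _ u cov s) u' cov' =
      SumList-filter⁻ g (SumList-↭ (↭-map⁺ g (filter-nonzero-↭ g u u' cov cov')) (SumList-filter⁺ g s))

    Sums-functional : ∀ {g : X → Carrier} {c d} → Sums g c → Sums g d → c ≡ d
    Sums-functional S (sums _ u cov s) = SumList-functional (Sums⇒SumList S u cov) s

    Sums-cong : ∀ {g h : X → Carrier} {c} → (∀ x → g x ≡ h x) → Sums g c → Sums h c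
    Sums-cong g≗h (sums L u cov s) =
      sums L u (λ x hx≢0 → cov x (hx≢0 ∘ trans (sym (g≗h x)))) (subst (λ l → SumList A l _) (map-cong g≗h L) s)

    Sums-zero : ∀ {g : X → Carrier} → (∀ x → g x ≡ 0#) → Sums g 0#
    Sums-zero g≗0 = sums [] [] (λ x gx≢0 → ⊥-elim (gx≢0 (g≗0 x))) []

    Sums-single : ∀ {g : X → Carrier} x₀ → (∀ x → x ≢ x₀ → g x ≡ 0#) → Sums g (g x₀)
    Sums-single {g} x₀ g≗0 =
      sums (x₀ ∷ []) ([] ∷ []) (λ x gx≢0 → here (em⇒dne em (gx≢0 ∘ g≗0 x))) (⊕-identityʳ (g x₀) ∷ [])

    Sums-positive : ∀ {g : X → Carrier} → Sums g 0# → ∀ x → g x ≡ 0#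
    Sums-positive (sums _ _ cov s) x =
      em⇒dne em (λ gx≢0 → gx≢0 (All.lookup (map⁻ (SumList-positive s)) (cov x gx≢0)))

    -- junk value: sum g = 0# when g has no sum
    sum : (X → Carrier) → Carrier
    sum g with em {∃ (Sums g)}
    ... | yes (c , _) = c
    ... | no _ = 0#

    sum-spec : ∀ {g : X → Carrier} → ∃ (Sums g) → Sums g (sum g)
    sum-spec {g} S with em {∃ (Sums g)}
    ... | yes (_ , s) = s
    ... | no ¬S = ⊥-elim (¬S S)

    sum-≡ : ∀ {g : X → Carrier} {c} → Sums g c → sum g ≡ c
    sum-≡ S = Sums-functional (sum-spec (_ , S)) S

    SumList-unzip : ∀ {u v w : X → Carrier} → (∀ x → v x ⊕ w x ≈ u x) → ∀ L {c} → SumList A (map u L) c →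
                    ∃ λ d → ∃ λ e → SumList A (map v L) d × SumList A (map w L) e × (d ⊕ e ≈ c)
    SumList-unzip split [] [] = _ , _ , [] , [] , ⊕-identityˡ 0#
    SumList-unzip split (x ∷ L) (p ∷ s) with SumList-unzip split L s
    ... | _ , _ , s₁ , s₂ , q with ⊕-interchange (split x) q p
    ... | _ , _ , t₁ , t₂ , t₃ = _ , _ , t₁ ∷ s₁ , t₂ ∷ s₂ , t₃

    Sums-summand : ∀ {u v : X → Carrier} (w : X → Carrier) {c} → (∀ x → v x ⊕ w x ≈ u x) → Sums u c →
                   ∃ (Sums v)
    Sums-summand w split (sums L un cov s) with SumList-unzip split L s
    ... | _ , _ , s₁ , _ , _ =
      _ , sums L un (λ x vx≢0 → cov x (λ ux≡0 → vx≢0 (⊕-positive (subst (_ ⊕ _ ≈_) ux≡0 (split x))))) s₁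

    Enumerates→Sums : ∀ {g : X → Carrier} {L c} → Enumerates L (λ x → g x ≢ 0#) → SumList A (map g L) c →
                      Sums g c
    Enumerates→Sums (u , _ , cov) s = sums _ u cov s

    Sums→Enumerates : ∀ {g : X → Carrier} {c} → Sums g c →
                      Σ (List X) λ L → Enumerates L (λ x → g x ≢ 0#) × SumList A (map g L) c
    Sums→Enumerates {g} (sums L u cov s) =
      filter (nonzero? g) L ,
      (Unique.filter⁺ (nonzero? g) u , (λ x m → proj₂ (∈-filter⁻ (nonzero? g) {xs = L} m)) ,
       (λ x gx≢0 → ∈-filter⁺ (nonzero? g) (cov x gx≢0) gx≢0)) ,
      SumList-filter⁺ g s

  module _ {X Y : Set} (k : X → Y → Carrier) where

    ColumnSums : List X → List Y → List Carrier → Set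
    ColumnSums Lx = Pointwise (λ y c → SumList A (map (λ x → k x y) Lx) c)

    private
      zeros : List Y → List Carrier
      zeros = map (λ _ → 0#)

      SumList-zeros : ∀ Ly → SumList A (zeros Ly) 0#
      SumList-zeros [] = []
      SumList-zeros (_ ∷ Ly) = ⊕-identityˡ 0# ∷ SumList-zeros Ly

      ColumnSums-[] : ∀ Ly → ColumnSums [] Ly (zeros Ly)
      ColumnSums-[] [] = []
      ColumnSums-[] (_ ∷ Ly) = [] ∷ ColumnSums-[] Ly

      ColumnSums-∷ : ∀ {x Lx} Ly {cs a b c} → SumList A (map (k x) Ly) a → ColumnSums Lx Ly cs →
                     SumList A cs b → a ⊕ b ≈ c → ∃ λ cs' → ColumnSums (x ∷ Lx) Ly cs' × SumList A cs' c
      ColumnSums-∷ [] [] [] [] q = [] , [] , subst (SumList A []) (sym (⊕-identityˡ-unique q)) []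
      ColumnSums-∷ (y ∷ Ly) (p ∷ s) (col ∷ cols) (q ∷ t) r with ⊕-interchange p q r
      ... | _ , _ , r₁ , r₂ , r₃ with ColumnSums-∷ Ly s cols t r₂
      ... | _ , cols' , t' = _ , (r₁ ∷ col) ∷ cols' , r₃ ∷ t'

    SumList-interchange : ∀ {r : X → Carrier} Lx Ly {c} → (∀ x → x ∈ Lx → SumList A (map (k x) Ly) (r x)) →
                          SumList A (map r Lx) c → ∃ λ cs → ColumnSums Lx Ly cs × SumList A cs c
    SumList-interchange [] Ly rows [] = _ , ColumnSums-[] Ly , SumList-zeros Ly
    SumList-interchange (x ∷ Lx) Ly rows (p ∷ s) with SumList-interchange Lx Ly (λ x' → rows x' ∘ there) s
    ... | _ , cols , t = ColumnSums-∷ Ly (rows x (here refl)) cols t p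

    column : Y → Carrier
    column y = sum (λ x → k x y)

    private
      module Fubini {r : X → Carrier} {c} (rows : ∀ x → Sums (k x) (r x)) (total : Sums r c) where
        open Sums

        _≟_ : DecidableEquality Y
        _ ≟ _ = em

        Lx : List X
        Lx = list total

        Ly : List Y
        Ly = deduplicate _≟_ (concat (map (list ∘ rows) Lx))

        Ly-unique : Unique Ly
        Ly-unique = UniqueDec.deduplicate-! _≟_ _

        support : ∀ {x y} → k x y ≢ 0# → x ∈ Lx × y ∈ Ly
        support {x} {y} kxy≢0 =
          x∈Lx , ∈-deduplicate⁺ _≟_ (∈-concat⁺′ (covers (rows x) y kxy≢0) (∈-map⁺ (list ∘ rows) x∈Lx))
          where
          x∈Lx : x ∈ Lx
          x∈Lx = covers total x (λ rx≡0 → kxy≢0 (Sums-positive (subst (Sums (k x)) rx≡0 (rows x)) y))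

        column-zero : ∀ {y} → y ∉ Ly → ∀ x → k x y ≡ 0#
        column-zero y∉Ly x = em⇒dne em (y∉Ly ∘ proj₂ ∘ support)

        column-over-Lx : ∀ {y c'} → SumList A (map (λ x → k x y) Lx) c' → Sums (λ x → k x y) c'
        column-over-Lx = sums Lx (unique total) (λ x → proj₁ ∘ support)

        interchanged : ∃ λ cs → ColumnSums Lx Ly cs × SumList A cs c
        interchanged = SumList-interchange Lx Ly
          (λ x _ → Sums⇒SumList (rows x) Ly-unique (λ y → proj₂ ∘ support)) (sumList total)

        column-Sums : ∀ y → Sums (λ x → k x y) (column y)
        column-Sums y with em {y ∈ Ly}
        ... | yes y∈Ly = sum-spec (_ , column-over-Lx (proj₂ (Pointwise-∈ (proj₁ (proj₂ interchanged)) y∈Ly)))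
        ... | no y∉Ly = sum-spec (_ , Sums-zero (column-zero y∉Ly))

        column-total : Sums column c
        column-total =
          sums Ly Ly-unique (λ y col≢0 → em⇒dne em (λ y∉Ly → col≢0 (sum-≡ (Sums-zero (column-zero y∉Ly)))))
               (subst (λ l → SumList A l c) (sym columns≡) (proj₂ (proj₂ interchanged)))
          where
          columns≡ : map column Ly ≡ proj₁ interchanged
          columns≡ = trans (Pointwise-≡⇒≡ (Pointwise.map⁺ column id
                       (Pointwise.map (sum-≡ ∘ column-over-Lx) (proj₁ (proj₂ interchanged)))))
                       (map-id _)

    Sums-fubini : ∀ {r : X → Carrier} {c} → (∀ x → Sums (k x) (r x)) → Sums r c →
                  (∀ y → Sums (λ x → k x y) (column y)) × Sums column c
    Sums-fubini rows total = Fubini.column-Sums rows total , Fubini.column-total rows total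

    Sums-swap : ∀ {r : X → Carrier} {s : Y → Carrier} {c} → (∀ x → Sums (k x) (r x)) → Sums r c →
                (∀ y → Sums (λ x → k x y) (s y)) → Sums s c
    Sums-swap rows total columns with Sums-fubini rows total
    ... | column-Sums , column-total =
      Sums-cong (λ y → Sums-functional (column-Sums y) (columns y)) column-total

  module _ {X Y : Set} (f : X → Y) where

    fibre : Y → (X → Carrier) → X → Carrier
    fibre y g x with em {f x ≡ y}
    ... | yes _ = g x
    ... | no _ = 0#

    fibre-∈ : ∀ {y g x} → f x ≡ y → fibre y g x ≡ g x
    fibre-∈ {y} {g} {x} fx≡y with em {f x ≡ y}
    ... | yes _ = refl
    ... | no fx≢y = ⊥-elim (fx≢y fx≡y)

    fibre-∉ : ∀ {y g x} → f x ≢ y → fibre y g x ≡ 0#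
    fibre-∉ {y} {g} {x} fx≢y with em {f x ≡ y}
    ... | yes fx≡y = ⊥-elim (fx≢y fx≡y)
    ... | no _ = refl

    fibre-zero : ∀ {y g x} → g x ≡ 0# → fibre y g x ≡ 0#
    fibre-zero {y} {g} {x} gx≡0 with em {f x ≡ y}
    ... | yes _ = gx≡0
    ... | no _ = refl

    fibre-nonzero : ∀ {y g x} → fibre y g x ≢ 0# → f x ≡ y × g x ≢ 0#
    fibre-nonzero {y} {g} {x} ≢0 with em {f x ≡ y}
    ... | yes fx≡y = fx≡y , ≢0
    ... | no _ = ⊥-elim (≢0 refl)

    Sums-fibres : ∀ {g : X → Carrier} {c} → Sums g c →
                  (∀ y → Sums (fibre y g) (sum (fibre y g))) × Sums (λ y → sum (fibre y g)) c
    Sums-fibres {g} = Sums-fubini (λ x y → fibre y g x) fibres-of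
      where
      fibres-of : ∀ x → Sums (λ y → fibre y g x) (g x)
      fibres-of x = subst (Sums _) (fibre-∈ refl) (Sums-single (f x) (λ y y≢fx → fibre-∉ (y≢fx ∘ sym)))

    Sums-fibre-pointwise : ∀ {J : Set} {h : J → X → Carrier} {s : X → Carrier} →
                           (∀ x → Sums (λ j → h j x) (s x)) →
                           ∀ {y} x → Sums (λ j → fibre y (h j) x) (fibre y s x)
    Sums-fibre-pointwise sums-at {y} x with em {f x ≡ y}
    ... | yes _ = sums-at x
    ... | no _ = Sums-zero (λ _ → refl)

  fibre-∘ : ∀ {X Y Z : Set} (f : X → Y) (g : Y → Z) {z y} (h : X → Carrier) x → g y ≡ z →
            fibre f y (fibre (g ∘ f) z h) x ≡ fibre f y h x
  fibre-∘ f g {z} {y} h x gy≡z with em {f x ≡ y}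
  ... | yes refl = fibre-∈ (g ∘ f) gy≡z
  ... | no _ = refl

  fibre-∘-∉ : ∀ {X Y Z : Set} (f : X → Y) (g : Y → Z) {z y} (h : X → Carrier) x → g y ≢ z →
              fibre f y (fibre (g ∘ f) z h) x ≡ 0#
  fibre-∘-∉ f g {z} {y} h x gy≢z with em {f x ≡ y}
  ... | yes refl = fibre-∉ (g ∘ f) gy≢z
  ... | no _ = refl

  module _ {X : Set} where

    _•_ : Carrier → X → X → Carrier
    e • x₀ = fibre id x₀ (λ _ → e)

    •-at : ∀ e x₀ → (e • x₀) x₀ ≡ e
    •-at e x₀ = fibre-∈ id refl

    •-off : ∀ e x₀ {x} → x ≢ x₀ → (e • x₀) x ≡ 0#
    •-off e x₀ = fibre-∉ id

    Sums-• : ∀ e x₀ → Sums (e • x₀) e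
    Sums-• e x₀ = subst (Sums _) (•-at e x₀) (Sums-single x₀ (λ x → •-off e x₀))

  Sums-fibre-• : ∀ {X Y : Set} (f : X → Y) e x₀ y → Sums (fibre f y (e • x₀)) ((e • f x₀) y)
  Sums-fibre-• f e x₀ y = subst (Sums _) at-x₀ (Sums-single x₀ (λ x x≢x₀ → fibre-zero f (•-off e x₀ x≢x₀)))
    where
    at-x₀ : fibre f y (e • x₀) x₀ ≡ (e • f x₀) y
    at-x₀ with em {f x₀ ≡ y}
    ... | yes refl = trans (•-at e x₀) (sym (•-at e (f x₀)))
    ... | no fx₀≢y = sym (•-off e (f x₀) (fx₀≢y ∘ sym))

  module _ {X : Set} where

    -- the finiteness witness of a Dist is irrelevant; excluded middle recovers a usable copy
    distribution : (Δ : Dist A X) → IsDistribution A (fun Δ)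
    distribution (dist g finite) with em {IsDistribution A g}
    ... | yes d = d
    ... | no ¬d = ⊥-elim-irr (¬d finite)

    Dist-Sums : (Δ : Dist A X) → Sums (fun Δ) (sum (fun Δ))
    Dist-Sums Δ with distribution Δ
    ... | _ , enum , c , s = sum-spec (c , Enumerates→Sums enum s)

    Sums⇒IsDistribution : ∀ {g : X → Carrier} {c} → Sums g c → IsDistribution A g
    Sums⇒IsDistribution S with Sums→Enumerates S
    ... | L , enum , s = L , enum , _ , s

module _ (em : ExcludedMiddle 0ℓ) {A B : EffectAlgebra} {φ : ⟨ A ⟩ → ⟨ B ⟩} (φ-hom : IsPCMHom A B φ) where
  open IsPCMHom φ-hom
  private
    module A = FiniteSums em A
    module B = FiniteSums em B

  SumList-hom : ∀ {X : Set} {g : X → ⟨ A ⟩} L {c} → SumList A (map g L) c → SumList B (map (φ ∘ g) L) (φ c)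
  SumList-hom [] [] = subst (SumList B []) (sym pres-0) []
  SumList-hom (x ∷ L) (p ∷ s) = pres-⊕ p ∷ SumList-hom L s

  Sums-hom : ∀ {X : Set} {g : X → ⟨ A ⟩} {c} → A.Sums g c → B.Sums (φ ∘ g) (φ c)
  Sums-hom (A.sums L u cov s) =
    B.sums L u (λ x φgx≢0 → cov x (λ gx≡0 → φgx≢0 (trans (cong φ gx≡0) pres-0))) (SumList-hom L s)

  fibre-hom : ∀ {X Y : Set} (f : X → Y) {y} (g : X → ⟨ A ⟩) x → φ (A.fibre f y g x) ≡ B.fibre f y (φ ∘ g) x
  fibre-hom f {y} g x with em {f x ≡ y}
  ... | yes _ = refl
  ... | no _ = pres-0

module GradedDistributionMonad (em : ExcludedMiddle 0ℓ) (ext : Extensionality 0ℓ 0ℓ)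
                               (M : PCM) (G : GradedEffectMonoid M) where
  open PCM M using (_⊕_≈_) renaming (Carrier to Grade; 0# to 0g)
  open GradedEffectMonoid G
  module ΣE (m : Grade) = FiniteSums em (E m)
  open ΣE hiding (_•_; •-at; •-off; Sums-•)
  open ΣE 0g using (_•_; •-at; •-off; Sums-•)

  D : Grade → Set → Set
  D m = Dist (E m)

  0E 1E : ∀ m → ⟨ E m ⟩
  0E m = EffectAlgebra.0# (E m)
  1E m = EffectAlgebra.1# (E m)

  module _ {m n k} (p : m ⊕ n ≈ k) where

    ∇-homˡ : ∀ b → IsPCMHom (E m) (E k) (λ a → ∇ p a b)
    ∇-homˡ = IsBimorphism.homˡ (∇-bimorphism p)

    ∇-homʳ : ∀ a → IsPCMHom (E n) (E k) (∇ p a)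
    ∇-homʳ = IsBimorphism.homʳ (∇-bimorphism p)

    ∇-zeroˡ : ∀ b → ∇ p (0E m) b ≡ 0E k
    ∇-zeroˡ b = IsPCMHom.pres-0 (∇-homˡ b)

    ∇-zeroʳ : ∀ a → ∇ p a (0E n) ≡ 0E k
    ∇-zeroʳ a = IsPCMHom.pres-0 (∇-homʳ a)

  η-one : η true ≡ 1E 0g
  η-one = trans (IsEffectMorphism.pres-′ η-morphism false)
                (cong (EffectAlgebra._′ (E 0g)) (IsEffectMorphism.pres-0 η-morphism))

  ∇-oneˡ : ∀ {m} (p : 0g ⊕ m ≈ m) a → ∇ p (1E 0g) a ≡ a
  ∇-oneˡ p a = trans (cong (λ e → ∇ p e a) (sym η-one)) (∇-identityˡ p a)

  ∇-oneʳ : ∀ {m} (p : m ⊕ 0g ≈ m) a → ∇ p a (1E 0g) ≡ a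
  ∇-oneʳ p a = trans (cong (∇ p a) (sym η-one)) (∇-identityʳ p a)

  Dist-ext : ∀ {m} {X : Set} {Δ Δ' : D m X} → (∀ x → fun Δ x ≡ fun Δ' x) → Δ ≡ Δ'
  Dist-ext = Dist-≡ ∘ ext

  fmap : ∀ m {X Y : Set} → (X → Y) → D m X → D m Y
  fmap m f Δ = dist (λ y → sum m (fibre m f y (fun Δ)))
                    (Sums⇒IsDistribution m (proj₂ (Sums-fibres m f (Dist-Sums m Δ))))

  fmap-Sums : ∀ m {X Y : Set} (f : X → Y) (Δ : D m X) y → Sums m (fibre m f y (fun Δ)) (fun (fmap m f Δ) y)
  fmap-Sums m f Δ = proj₁ (Sums-fibres m f (Dist-Sums m Δ))

  unit : ∀ {X : Set} → X → D 0g X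
  unit x = dist (1E 0g • x) (Sums⇒IsDistribution 0g (Sums-• (1E 0g) x))

  mult-term : ∀ {m n k} → m ⊕ n ≈ k → ∀ {X : Set} → D m (D n X) → D n X → X → ⟨ E k ⟩
  mult-term p Φ Δ x = ∇ p (fun Φ Δ) (fun Δ x)

  private
    mult-fubini : ∀ {m n k} (p : m ⊕ n ≈ k) {X : Set} (Φ : D m (D n X)) →
                  (∀ x → Sums k (λ Δ → mult-term p Φ Δ x) (column k (mult-term p Φ) x)) ×
                  ∃ (Sums k (column k (mult-term p Φ)))
    mult-fubini {m} {n} {k} p {X} Φ = Product.map₂ (_ ,_) (Sums-fubini k (mult-term p Φ) rows (proj₂ weights))
      where
      mass : D n X → ⟨ E n ⟩
      mass Δ = sum n (fun Δ)

      rows : ∀ Δ → Sums k (mult-term p Φ Δ) (∇ p (fun Φ Δ) (mass Δ))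
      rows Δ = Sums-hom em (∇-homʳ p (fun Φ Δ)) (Dist-Sums n Δ)

      weights : ∃ (Sums k (λ Δ → ∇ p (fun Φ Δ) (mass Δ)))
      weights = Sums-summand k (λ Δ → ∇ p (fun Φ Δ) (EffectAlgebra._′ (E n) (mass Δ)))
        (λ Δ → IsPCMHom.pres-⊕ (∇-homʳ p (fun Φ Δ)) (EffectAlgebra.′-sum (E n) (mass Δ)))
        (Sums-hom em (∇-homˡ p (1E n)) (Dist-Sums m Φ))

  mult : ∀ {m n k} → m ⊕ n ≈ k → ∀ {X : Set} → D m (D n X) → D k X
  mult {k = k} p Φ =
    dist (column k (mult-term p Φ)) (Sums⇒IsDistribution k (proj₂ (proj₂ (mult-fubini p Φ))))

  mult-Sums : ∀ {m n k} (p : m ⊕ n ≈ k) {X : Set} (Φ : D m (D n X)) x →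
              Sums k (λ Δ → mult-term p Φ Δ x) (fun (mult p Φ) x)
  mult-Sums p Φ = proj₁ (mult-fubini p Φ)

  fmap-spec : ∀ m {X Y : Set} (f : X → Y) (Δ : D m X) → FmapSpec (E m) f Δ (fmap m f Δ)
  fmap-spec m f Δ y with Sums→Enumerates m (fmap-Sums m f Δ y)
  ... | L , (u , ⊆support , support⊆) , s =
    L , (u , in-fibre , fibre⊆) , subst (λ l → SumList (E m) l _) (map-cong-local (All.tabulate restrict)) s
    where
    in-fibre : ∀ x → x ∈ L → f x ≡ y × fun Δ x ≢ 0E m
    in-fibre x = fibre-nonzero m f ∘ ⊆support x

    fibre⊆ : ∀ x → f x ≡ y × fun Δ x ≢ 0E m → x ∈ L
    fibre⊆ x (fx≡y , Δx≢0) = support⊆ x (Δx≢0 ∘ trans (sym (fibre-∈ m f fx≡y)))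

    restrict : ∀ {x} → x ∈ L → fibre m f y (fun Δ) x ≡ fun Δ x
    restrict = fibre-∈ m f ∘ proj₁ ∘ in-fibre _

  fmap-id : ∀ m {X : Set} (Δ : D m X) → fmap m id Δ ≡ Δ
  fmap-id m Δ = Dist-ext λ y →
    sum-≡ m (subst (Sums m _) (fibre-∈ m id refl) (Sums-single m y (λ x → fibre-∉ m id)))

  fmap-∘ : ∀ m {X Y Z : Set} (f : X → Y) (g : Y → Z) (Δ : D m X) → fmap m (g ∘ f) Δ ≡ fmap m g (fmap m f Δ)
  fmap-∘ m f g Δ = Dist-ext λ z → begin
    sum m (fibre m (g ∘ f) z (fun Δ))
      ≡⟨ sym (sum-≡ m (proj₂ (Sums-fibres m f (fmap-Sums m (g ∘ f) Δ z)))) ⟩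
    sum m (λ y → sum m (fibre m f y (fibre m (g ∘ f) z (fun Δ))))
      ≡⟨ cong (sum m) (ext (fibre-of-fibre z)) ⟩
    sum m (fibre m g z (fun (fmap m f Δ))) ∎
    where
    fibre-of-fibre : ∀ z y → sum m (fibre m f y (fibre m (g ∘ f) z (fun Δ))) ≡ fibre m g z (fun (fmap m f Δ)) y
    fibre-of-fibre z y with em {g y ≡ z}
    ... | yes gy≡z = cong (sum m) (ext λ x → fibre-∘ m f g (fun Δ) x gy≡z)
    ... | no gy≢z = sum-≡ m (Sums-zero m λ x → fibre-∘-∉ m f g (fun Δ) x gy≢z)

  unit-natural : ∀ {X Y : Set} (f : X → Y) (x : X) → fmap 0g f (unit x) ≡ unit (f x)
  unit-natural f x = Dist-ext λ y → sum-≡ 0g (Sums-fibre-• 0g f (1E 0g) x y)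

  mult-spec : ∀ {m n k} (p : m ⊕ n ≈ k) {X : Set} (Φ : D m (D n X)) (x : X) →
              Σ (List (D n X)) λ L → Enumerates L (λ Δ → fun Φ Δ ≢ 0E m)
                × SumList (E k) (map (λ Δ → ∇ p (fun Φ Δ) (fun Δ x)) L) (fun (mult p Φ) x)
  mult-spec {m} {k = k} p Φ x with Sums→Enumerates m (Dist-Sums m Φ)
  ... | L , enum@(u , _ , support⊆) , _ =
    L , enum , Sums⇒SumList k (mult-Sums p Φ x) u terms⊆
    where
    terms⊆ : SupportIn k (λ Δ → mult-term p Φ Δ x) L
    terms⊆ Δ term≢0 = support⊆ Δ λ ΦΔ≡0 → term≢0 (trans (cong (λ a → ∇ p a (fun Δ x)) ΦΔ≡0) (∇-zeroˡ p _))

  mult-fmap-Sums : ∀ {m n k} (p : m ⊕ n ≈ k) {X Z : Set} (g : Z → D n X) (Φ : D m Z) x →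
                   Sums k (λ z → ∇ p (fun Φ z) (fun (g z) x)) (fun (mult p (fmap m g Φ)) x)
  mult-fmap-Sums {m} {k = k} p g Φ x =
    Sums-swap k (λ Θ z → ∇ p (fibre m g Θ (fun Φ) z) (fun Θ x)) rows (mult-Sums p (fmap m g Φ) x) columns
    where
    rows : ∀ Θ → Sums k (λ z → ∇ p (fibre m g Θ (fun Φ) z) (fun Θ x)) (mult-term p (fmap m g Φ) Θ x)
    rows Θ = Sums-hom em (∇-homˡ p (fun Θ x)) (fmap-Sums m g Φ Θ)

    columns : ∀ z → Sums k (λ Θ → ∇ p (fibre m g Θ (fun Φ) z) (fun Θ x)) (∇ p (fun Φ z) (fun (g z) x))
    columns z = subst (Sums k _) (cong (λ a → ∇ p a (fun (g z) x)) (fibre-∈ m g refl))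
      (Sums-single k (g z) λ Θ Θ≢gz →
        trans (cong (λ a → ∇ p a (fun Θ x)) (fibre-∉ m g (Θ≢gz ∘ sym))) (∇-zeroˡ p (fun Θ x)))

  mult-natural : ∀ {m n k} (p : m ⊕ n ≈ k) {X Y : Set} (f : X → Y) (Φ : D m (D n X)) →
                 mult p (fmap m (fmap n f) Φ) ≡ fmap k f (mult p Φ)
  mult-natural {m} {n} {k} p f Φ = Dist-ext λ y → Sums-functional k (mult-fmap-Sums p (fmap n f) Φ y)
    (Sums-swap k (λ x Δ → fibre k f y (mult-term p Φ Δ) x)
      (Sums-fibre-pointwise k f (mult-Sums p Φ)) (fmap-Sums k f (mult p Φ) y) (columns y))
    where
    columns : ∀ y Δ → Sums k (λ x → fibre k f y (mult-term p Φ Δ) x) (∇ p (fun Φ Δ) (fun (fmap n f Δ) y))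
    columns y Δ = Sums-cong k (fibre-hom em (∇-homʳ p (fun Φ Δ)) f (fun Δ))
                  (Sums-hom em (∇-homʳ p (fun Φ Δ)) (fmap-Sums n f Δ y))

  mult-assoc : ∀ {m n o mn no k}
               (p : m ⊕ n ≈ mn) (q : mn ⊕ o ≈ k) (r : n ⊕ o ≈ no) (s : m ⊕ no ≈ k)
               {X : Set} (Φ : D m (D n (D o X))) →
               mult s (fmap m (mult r) Φ) ≡ mult q (mult p Φ)
  mult-assoc {k = k} p q r s Φ = Dist-ext λ x → sym (Sums-functional k (mult-Sums q (mult p Φ) x)
    (Sums-swap k (λ Ψ Δ → ∇ s (fun Φ Ψ) (∇ r (fun Ψ Δ) (fun Δ x)))
      (λ Ψ → Sums-hom em (∇-homʳ s (fun Φ Ψ)) (mult-Sums r Ψ x))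
      (mult-fmap-Sums s (mult r) Φ x)
      (λ Δ → Sums-cong k (λ Ψ → ∇-assoc p q r s (fun Φ Ψ) (fun Ψ Δ) (fun Δ x))
               (Sums-hom em (∇-homˡ q (fun Δ x)) (mult-Sums p Φ Δ)))))

  mult-unitʳ : ∀ {m} (p : m ⊕ 0g ≈ m) {X : Set} (Δ : D m X) → mult p (fmap m unit Δ) ≡ Δ
  mult-unitʳ {m} p Δ = Dist-ext λ x → Sums-functional m (mult-fmap-Sums p unit Δ x)
    (subst (Sums m _) (trans (cong (∇ p (fun Δ x)) (•-at (1E 0g) x)) (∇-oneʳ p (fun Δ x)))
      (Sums-single m x λ x' x'≢x →
        trans (cong (∇ p (fun Δ x')) (•-off (1E 0g) x' (x'≢x ∘ sym))) (∇-zeroʳ p (fun Δ x'))))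

  mult-unitˡ : ∀ {m} (p : 0g ⊕ m ≈ m) {X : Set} (Δ : D m X) → mult p (unit Δ) ≡ Δ
  mult-unitˡ {m} p Δ = Dist-ext λ x → Sums-functional m (mult-Sums p (unit Δ) x)
    (subst (Sums m _) (trans (cong (λ e → ∇ p e (fun Δ x)) (•-at (1E 0g) Δ)) (∇-oneˡ p (fun Δ x)))
      (Sums-single m Δ λ Θ Θ≢Δ →
        trans (cong (λ e → ∇ p e (fun Θ x)) (•-off (1E 0g) Δ Θ≢Δ)) (∇-zeroˡ p (fun Θ x))))

  monad : DGradedMonad M G
  monad = record
    { fmap = fmap
    ; fmap-spec = fmap-spec
    ; fmap-id = fmap-id
    ; fmap-∘ = fmap-∘
    ; unit = unit
    ; unit-spec = λ x → •-at (1E 0g) x , λ y → •-off (1E 0g) x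
    ; mult = mult
    ; mult-spec = mult-spec
    ; unit-natural = unit-natural
    ; mult-natural = mult-natural
    ; mult-assoc = mult-assoc
    ; mult-unitʳ = mult-unitʳ
    ; mult-unitˡ = mult-unitˡ
    }

mainTheorem2 : ExcludedMiddle 0ℓ → Extensionality 0ℓ 0ℓ →
               (M : PCM) (G : GradedEffectMonoid M) → DGradedMonad M G
mainTheorem2 = GradedDistributionMonad.monad
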